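{- Let $k$ be a positive integer, $n\ge 0$ an integer, and $a_1,\ldots,a_k$ non-negative integers with $a_1+\cdots+a_k=n$. Then \[ \big|\mathcal{K}_{k,k-1}^{n}(a_1,\ldots,a_k)\big| = \frac{1}{n+1}\prod_{i=1}^{k}\binom{n+a_i}{a_i}. \]
   Context: For non-negative integers $k,t,n$ with $0\le t<k$, a $k_t$-Dyck path of length $(k+1)n$ is a lattice path consisting of $n$ down-steps $(1,-k)$ and $kn$ up-steps $(1,1)$ that starts at $(0,0)$, ends at $((k+1)n,0)$, and stays weakly above the line $y=-t$. For non-negative integers $a_1,\ldots,a_k$ with $a_1+\cdots+a_k=n$, $\mathcal{K}_{k,t}^{n}(a_1,\ldots,a_k)$ denotes the set of $k_t$-Dyck paths of length $(k+1)n$ having, for each $1\le i\le k$, exactly $a_i$ down-steps whose endpoints are at a height congruent to $i$ modulo $k$. -}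

module Defs where

open import Data.Nat as ℕ using (ℕ; zero; suc; _+_; _*_; _∸_)
import Data.Nat.Properties as ℕP
open import Data.Integer as ℤ using (ℤ; +_; -_)
import Data.Integer.Properties as ℤP
open import Data.Integer.Divisibility.Signed using (_∣_; _∣?_)
open import Data.Fin using (Fin; toℕ)
open import Data.Fin.Properties using (all?)
open import Data.List using (List; []; _∷_; length; filter; map; concatMap; tabulate)
open import Data.Nat.ListAction using (sum; product)
open import Data.List.Relation.Unary.All as All using (All)
open import Data.Product using (_×_; _,_)
open import Relation.Nullary using (Dec; yes; no)
open import Relation.Nullary.Decidable using (_×-dec_)
open import Relation.Binary.PropositionalEquality using (_≡_)

-- Steps of a lattice path: U = up-step (1,1), D = down-step (1,-k).
data Step : Set where
  U D : Step

allPaths : ℕ → List (List Step)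
allPaths zero    = [] ∷ []
allPaths (suc m) = concatMap (λ p → (U ∷ p) ∷ (D ∷ p) ∷ []) (allPaths m)

δ : ℕ → Step → ℤ
δ k U = + 1
δ k D = - (+ k)

heights : ℕ → ℤ → List Step → List ℤ
heights k h []       = []
heights k h (s ∷ p)  = (h ℤ.+ δ k s) ∷ heights k (h ℤ.+ δ k s) p

finalHeight : ℕ → ℤ → List Step → ℤ
finalHeight k h []      = h
finalHeight k h (s ∷ p) = finalHeight k (h ℤ.+ δ k s) p

downEnds : ℕ → ℤ → List Step → List ℤ
downEnds k h []      = []
downEnds k h (U ∷ p) = downEnds k (h ℤ.+ δ k U) p
downEnds k h (D ∷ p) = (h ℤ.+ δ k D) ∷ downEnds k (h ℤ.+ δ k D) p

isU? : (s : Step) → Dec (s ≡ U)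
isU? U = yes _≡_.refl
isU? D = no (λ ())

isD? : (s : Step) → Dec (s ≡ D)
isD? U = no (λ ())
isD? D = yes _≡_.refl

countU countD : List Step → ℕ
countU p = length (filter isU? p)
countD p = length (filter isD? p)

IsKtDyck : ℕ → ℕ → ℕ → List Step → Set
IsKtDyck k t n p =
  length p ≡ (k + 1) * n ×
  countD p ≡ n ×
  countU p ≡ k * n ×
  finalHeight k (+ 0) p ≡ + 0 ×
  All (λ h → - (+ t) ℤ.≤ h) (heights k (+ 0) p)

isKtDyck? : ∀ k t n p → Dec (IsKtDyck k t n p)
isKtDyck? k t n p =
  (length p ℕ.≟ (k + 1) * n) ×-dec
  (countD p ℕ.≟ n) ×-dec
  (countU p ℕ.≟ k * n) ×-dec
  (finalHeight k (+ 0) p ℤ.≟ + 0) ×-dec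
  All.all? (λ h → - (+ t) ℤ.≤? h) (heights k (+ 0) p)

downCountMod : ℕ → ℕ → List Step → ℕ
downCountMod k j p = length (filter (λ h → (+ k) ∣? (h ℤ.- + j)) (downEnds k (+ 0) p))

-- a : Fin k → ℕ, where a i stands for a_{i+1} (i = 0, …, k-1)
HasType : (k : ℕ) → (Fin k → ℕ) → List Step → Set
HasType k a p = ∀ (i : Fin k) → downCountMod k (suc (toℕ i)) p ≡ a i

hasType? : ∀ k a p → Dec (HasType k a p)
hasType? k a p = all? (λ i → downCountMod k (suc (toℕ i)) p ℕ.≟ a i)

InK : (k t n : ℕ) → (Fin k → ℕ) → List Step → Set
InK k t n a p = IsKtDyck k t n p × HasType k a p

inK? : ∀ k t n a p → Dec (InK k t n a p)
inK? k t n a p = isKtDyck? k t n p ×-dec hasType? k a p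

-- |K^n_{k,t}(a_1,…,a_k)|: all candidate paths are words of length (k+1)n
cardK : (k t n : ℕ) → (Fin k → ℕ) → ℕ
cardK k t n a = length (filter (inK? k t n a) (allPaths ((k + 1) * n)))

Σᶠ Πᶠ : (k : ℕ) → (Fin k → ℕ) → ℕ
Σᶠ k f = sum (tabulate f)
Πᶠ k f = product (tabulate f)

-- A path in K^n_{k,k-1}(a₁, …, a_k) cannot start with a down-step, so it is a sequence of kn
-- up-steps, each followed by a run of down-steps.  Cutting the kn run lengths into rows of k gives an
-- n × k matrix: the down-steps in column s end at heights ≡ s + 1 (mod k), so the column sums are
-- a₁, …, a_k, and the path stays weakly above y = 1 - k exactly when the row sums satisfy
-- r₁ + ⋯ + r_j ≤ j for all j.  With an extra zero row on top, these are the (n+1)-row matrices with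
-- column sums a whose row sums have all prefix sums r₀ + ⋯ + r_j < j + 1.  By the cycle lemma, exactly
-- one of the n + 1 cyclic rotations of any (n+1)-row matrix with column sums a (total n) has this
-- property.  So (n + 1)·|K| counts all (n+1)-row matrices with column sums a, which is
-- ∏ᵢ C(n + aᵢ, aᵢ), as column i is any composition of aᵢ into n + 1 parts.

module Submission where

open import Defs
open import Data.Bool using (Bool; true; false; if_then_else_)
open import Data.Empty using (⊥)
open import Data.Fin as Fin using (Fin; toℕ)
import Data.Fin.Properties as Finₚ
open import Data.Integer as ℤ using (ℤ; _⊖_; 0ℤ)
import Data.Integer.Properties as ℤₚ
open import Data.Integer.Divisibility.Signed using (_∣_; divides; _∣?_; ∣m+n∣m⇒∣n; ∣m∣n⇒∣m+n; ∣n⇒∣m*n; ∣-refl; ∣⇒∣ᵤ)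
import Data.Integer.Tactic.RingSolver as ℤ-Ring
open import Data.List as List using (List; []; _∷_; [_]; _++_; length; map; filter; concatMap; replicate; take; drop; downFrom)
open import Data.List.Properties
  using ( length-++; length-map; length-replicate; length-take; length-drop; length-downFrom; length-++-comm
        ; map-++; map-∘; map-cong; map-cong-local; map-tabulate; filter-++; filter-accept; filter-reject; filter-none
        ; ∷-injectiveˡ; ∷-injectiveʳ; ++-assoc; concatMap-++; take-[]; take++drop≡id; take-take; take-all; drop-map; take-map )
open import Data.List.Membership.Propositional using (_∈_)
open import Data.List.Membership.Propositional.Properties
  using (∈-map⁺; ∈-map⁻; ∈-filter⁺; ∈-filter⁻; ∈-concat⁺′; ∈-concat⁻′; ∈-downFrom⁺; ∈-downFrom⁻)
open import Data.List.Membership.Propositional.Properties.WithK using (unique∧set⇒bag)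
open import Data.List.Relation.Binary.BagAndSetEquality using (∼bag⇒↭)
open import Data.List.Relation.Binary.Permutation.Propositional.Properties using (↭-length)
open import Data.List.Relation.Unary.Any using (here; there)
open import Data.List.Relation.Unary.All as All using (All; []; _∷_)
import Data.List.Relation.Unary.All.Properties as Allₚ
import Data.List.Relation.Unary.AllPairs as AllPairs
import Data.List.Relation.Unary.AllPairs.Properties as AllPairsₚ
open import Data.List.Relation.Unary.Unique.Propositional using (Unique)
import Data.List.Relation.Unary.Unique.Propositional.Properties as Uniqueₚ
open import Data.Nat using (ℕ; zero; suc; _+_; _*_; _∸_; _≤_; _<_; z≤n; s≤s; s≤s⁻¹; z<s; _<?_)
open import Data.Nat.Properties
import Data.Nat.Divisibility as ℕᵈ
open import Data.Nat.Combinatorics using (_C_; nCn≡1; nCk+nC[k+1]≡[n+1]C[k+1])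
open import Data.Nat.ListAction using (sum; product)
open import Data.Nat.ListAction.Properties using (sum-++)
open import Data.Nat.Tactic.RingSolver using (solve-∀)
open import Data.Product as Product using (Σ-syntax; ∃₂; _×_; _,_; proj₁; proj₂; uncurry)
open import Data.Sum using (inj₁; inj₂)
open import Data.Unit using (⊤; tt)
open import Data.Vec as Vec using (Vec; []; _∷_; toList; lookup; zipWith; group)
import Data.Vec.Properties as Vecₚ
open import Data.Vec.Relation.Binary.Pointwise.Inductive using (Pointwise; []; _∷_)
open import Function using (_∘_; _⇔_; mk⇔; Equivalence)
open import Level using (0ℓ)
open import Relation.Binary.Definitions using (tri<; tri≈; tri>)
open import Relation.Binary.PropositionalEquality hiding ([_])
open import Relation.Nullary using (Dec; yes; no; contradiction)
open import Relation.Nullary.Decidable using (_×-dec_)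
open import Relation.Unary using (Pred; Decidable)
open import Algebra.Properties.CommutativeSemigroup +-commutativeSemigroup using (x∙yz≈y∙xz; interchange)

private
  variable
    A B I T Z : Set
    m : ℕ

-- Counting in lists

count : {P : Pred A 0ℓ} → Decidable P → List A → ℕ
count P? xs = length (filter P? xs)

module _ {P : Pred A 0ℓ} (P? : Decidable P) where

  count-++ : ∀ xs ys → count P? (xs ++ ys) ≡ count P? xs + count P? ys
  count-++ xs ys = trans (cong length (filter-++ P? xs ys)) (length-++ (filter P? xs))

  count-map : (f : B → A) (xs : List B) → count P? (map f xs) ≡ count (λ x → P? (f x)) xs
  count-map f [] = refl
  count-map f (x ∷ xs) with P? (f x)
  ... | yes _ = cong suc (count-map f xs)
  ... | no _  = count-map f xs

count-cong : {P Q : Pred A 0ℓ} (P? : Decidable P) (Q? : Decidable Q) (xs : List A) →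
  (∀ {x} → x ∈ xs → P x ⇔ Q x) → count P? xs ≡ count Q? xs
count-cong P? Q? [] _ = refl
count-cong P? Q? (x ∷ xs) P⇔Q with P? x | Q? x
... | yes _  | yes _  = cong suc (count-cong P? Q? xs (P⇔Q ∘ there))
... | no _   | no _   = count-cong P? Q? xs (P⇔Q ∘ there)
... | yes px | no ¬qx = contradiction (Equivalence.to (P⇔Q (here refl)) px) ¬qx
... | no ¬px | yes qx = contradiction (Equivalence.from (P⇔Q (here refl)) qx) ¬px

count-≟-downFrom : ∀ {q} N → q < N → count (_≟ q) (downFrom N) ≡ 1
count-≟-downFrom {q} (suc N) q<1+N with N ≟ q
... | yes refl = cong length (trans (filter-accept (_≟ q) refl) (cong (q ∷_) (filter-none (_≟ q) below-q)))
  where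
  below-q : All (_≢ q) (downFrom q)
  below-q = All.tabulate (λ m∈ m≡q → <-irrefl m≡q (∈-downFrom⁻ m∈))
... | no N≢q = trans (cong length (filter-reject (_≟ q) N≢q)) (count-≟-downFrom N (≤∧≢⇒< (s≤s⁻¹ q<1+N) (N≢q ∘ sym)))

unique-length-≡ : {xs ys : List A} → Unique xs → Unique ys → (∀ {z} → z ∈ xs ⇔ z ∈ ys) → length xs ≡ length ys
unique-length-≡ xs! ys! xs⇔ys = ↭-length (∼bag⇒↭ (unique∧set⇒bag xs! ys! xs⇔ys))

count-unique-≡ : {P : Pred A 0ℓ} (P? : Decidable P) {xs ys : List A} → Unique xs → Unique ys →
  (∀ {z} → z ∈ xs ⇔ z ∈ ys) → count P? xs ≡ count P? ys
count-unique-≡ P? {xs} {ys} xs! ys! xs⇔ys = unique-length-≡ (Uniqueₚ.filter⁺ P? xs!) (Uniqueₚ.filter⁺ P? ys!) (mk⇔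
  (λ z∈ → let z∈xs , Pz = ∈-filter⁻ P? z∈ in ∈-filter⁺ P? (Equivalence.to xs⇔ys z∈xs) Pz)
  (λ z∈ → let z∈ys , Pz = ∈-filter⁻ P? z∈ in ∈-filter⁺ P? (Equivalence.from xs⇔ys z∈ys) Pz))

sum-map-const : (c : ℕ) (xs : List A) → sum (map (λ _ → c) xs) ≡ length xs * c
sum-map-const c [] = refl
sum-map-const c (x ∷ xs) = cong (c +_) (sum-map-const c xs)

sum-count-comm : {A B : Set} {R : A → B → Set} (R? : ∀ x y → Dec (R x y)) (xs : List A) (ys : List B) →
  sum (map (λ x → count (R? x) ys) xs) ≡ sum (map (λ y → count (λ x → R? x y) xs) ys)
sum-count-comm R? [] ys = sym (trans (sum-map-const 0 ys) (*-zeroʳ (length ys)))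
sum-count-comm {A} {B} R? (x ∷ xs) ys =
  trans (cong (count (R? x) ys +_) (sum-count-comm R? xs ys)) (add-row ys)
  where
  column : B → List A → ℕ
  column y = count (λ x′ → R? x′ y)
  add-row : ∀ ys → count (R? x) ys + sum (map (λ y → column y xs) ys) ≡ sum (map (λ y → column y (x ∷ xs)) ys)
  add-row [] = refl
  add-row (y ∷ ys) with R? x y
  ... | yes _ = cong suc (trans (x∙yz≈y∙xz (count (R? x) ys) (column y xs) _) (cong (column y xs +_) (add-row ys)))
  ... | no _  = trans (x∙yz≈y∙xz (count (R? x) ys) (column y xs) _) (cong (column y xs +_) (add-row ys))

length-concatMap : (f : A → List B) (xs : List A) → length (concatMap f xs) ≡ sum (map (length ∘ f) xs)
length-concatMap f [] = refl
length-concatMap f (x ∷ xs) = trans (length-++ (f x)) (cong (length (f x) +_) (length-concatMap f xs))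

sum-map-concatMap : (g : B → ℕ) (f : A → List B) (xs : List A) →
  sum (map g (concatMap f xs)) ≡ sum (map (λ x → sum (map g (f x))) xs)
sum-map-concatMap g f [] = refl
sum-map-concatMap g f (x ∷ xs) = begin
  sum (map g (f x ++ concatMap f xs))             ≡⟨ cong sum (map-++ g (f x) _) ⟩
  sum (map g (f x) ++ map g (concatMap f xs))     ≡⟨ sum-++ (map g (f x)) _ ⟩
  sum (map g (f x)) + sum (map g (concatMap f xs)) ≡⟨ cong (sum (map g (f x)) +_) (sum-map-concatMap g f xs) ⟩
  sum (map (λ x → sum (map g (f x))) (x ∷ xs))    ∎
  where open ≡-Reasoning

sum-map-*ˡ : (c : ℕ) (g : A → ℕ) (xs : List A) → sum (map (λ x → c * g x) xs) ≡ c * sum (map g xs)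
sum-map-*ˡ c g [] = sym (*-zeroʳ c)
sum-map-*ˡ c g (x ∷ xs) = trans (cong (c * g x +_) (sum-map-*ˡ c g xs)) (sym (*-distribˡ-+ c (g x) _))

sum-map-*ʳ : (c : ℕ) (g : A → ℕ) (xs : List A) → sum (map (λ x → g x * c) xs) ≡ sum (map g xs) * c
sum-map-*ʳ c g [] = refl
sum-map-*ʳ c g (x ∷ xs) = trans (cong (g x * c +_) (sum-map-*ʳ c g xs)) (sym (*-distribʳ-+ c (g x) _))

module _ (f : I → T → Z) (ts : I → List T) where

  ∈-concatMap-map⁺ : ∀ {js j t} → j ∈ js → t ∈ ts j → f j t ∈ concatMap (λ j → map (f j) (ts j)) js
  ∈-concatMap-map⁺ j∈ t∈ = ∈-concat⁺′ (∈-map⁺ (f _) t∈) (∈-map⁺ (λ j → map (f j) (ts j)) j∈)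

  ∈-concatMap-map⁻ : ∀ js {z} → z ∈ concatMap (λ j → map (f j) (ts j)) js →
    ∃₂ λ j t → j ∈ js × t ∈ ts j × z ≡ f j t
  ∈-concatMap-map⁻ js z∈ with ∈-concat⁻′ (map (λ j → map (f j) (ts j)) js) z∈
  ... | _ , z∈fts , fts∈ with ∈-map⁻ (λ j → map (f j) (ts j)) fts∈
  ... | j , j∈ , refl with ∈-map⁻ (f j) z∈fts
  ... | t , t∈ , refl = j , t , j∈ , t∈ , refl

  concatMap-map-unique : ∀ {js} → Unique js → (∀ j → Unique (map (f j) (ts j))) →
    (∀ {j j′ t t′} → t ∈ ts j → t′ ∈ ts j′ → f j t ≡ f j′ t′ → j ≡ j′) →
    Unique (concatMap (λ j → map (f j) (ts j)) js)
  concatMap-map-unique js! fts! f-determines-j =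
    Uniqueₚ.concat⁺ (Allₚ.map⁺ (All.tabulate (λ {j} _ → fts! j))) (AllPairsₚ.map⁺ (AllPairs.map disjoint js!))
    where
    disjoint : ∀ {j j′} → j ≢ j′ → ∀ {z} → z ∈ map (f j) (ts j) × z ∈ map (f j′) (ts j′) → ⊥
    disjoint j≢j′ (z∈ , z∈′) with ∈-map⁻ (f _) z∈ | ∈-map⁻ (f _) z∈′
    ... | _ , t∈ , refl | _ , t′∈ , eq = j≢j′ (f-determines-j t∈ t′∈ eq)

-- Matrices with prescribed column sums

infixl 6 _+ᵛ_ _∸ᵛ_
infix 4 _≤ᵛ_

_+ᵛ_ _∸ᵛ_ : Vec ℕ m → Vec ℕ m → Vec ℕ m
_+ᵛ_ = zipWith _+_
_∸ᵛ_ = zipWith _∸_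

0ᵛ : Vec ℕ m
0ᵛ = Vec.replicate _ 0

_≤ᵛ_ : Vec ℕ m → Vec ℕ m → Set
_≤ᵛ_ = Pointwise _≤_

∸ᵛ-+ᵛ : {b c : Vec ℕ m} → c ≤ᵛ b → (b ∸ᵛ c) +ᵛ c ≡ b
∸ᵛ-+ᵛ [] = refl
∸ᵛ-+ᵛ (y≤x ∷ c≤b) = cong₂ _∷_ (m∸n+n≡m y≤x) (∸ᵛ-+ᵛ c≤b)

+ᵛ-∸ᵛ : (r c : Vec ℕ m) → (r +ᵛ c) ∸ᵛ c ≡ r
+ᵛ-∸ᵛ [] [] = refl
+ᵛ-∸ᵛ (x ∷ r) (y ∷ c) = cong₂ _∷_ (m+n∸n≡m x y) (+ᵛ-∸ᵛ r c)

≤ᵛ-+ᵛ : (r c : Vec ℕ m) → c ≤ᵛ r +ᵛ c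
≤ᵛ-+ᵛ [] [] = []
≤ᵛ-+ᵛ (x ∷ r) (y ∷ c) = m≤n+m y x ∷ ≤ᵛ-+ᵛ r c

sum-+ᵛ : (r c : Vec ℕ m) → sum (toList (r +ᵛ c)) ≡ sum (toList r) + sum (toList c)
sum-+ᵛ [] [] = refl
sum-+ᵛ (x ∷ r) (y ∷ c) = trans (cong (x + y +_) (sum-+ᵛ r c)) (interchange x y _ _)

sum-0ᵛ : ∀ m → sum (toList (0ᵛ {m})) ≡ 0
sum-0ᵛ zero = refl
sum-0ᵛ (suc m) = sum-0ᵛ m

below : Vec ℕ m → List (Vec ℕ m)
below [] = [ [] ]
below (x ∷ b) = concatMap (λ j → map (j ∷_) (below b)) (downFrom (suc x))

∈-below⁺ : {b c : Vec ℕ m} → c ≤ᵛ b → c ∈ below b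
∈-below⁺ [] = here refl
∈-below⁺ {b = _ ∷ b} (y≤x ∷ c≤b) = ∈-concatMap-map⁺ _∷_ (λ _ → below b) (∈-downFrom⁺ (s≤s y≤x)) (∈-below⁺ c≤b)

∈-below⁻ : (b : Vec ℕ m) {c : Vec ℕ m} → c ∈ below b → c ≤ᵛ b
∈-below⁻ [] {[]} _ = []
∈-below⁻ (x ∷ b) c∈ with ∈-concatMap-map⁻ _∷_ (λ _ → below b) (downFrom (suc x)) c∈
... | j , c , j∈ , c∈ , refl = s≤s⁻¹ (∈-downFrom⁻ j∈) ∷ ∈-below⁻ b c∈

below-unique : (b : Vec ℕ m) → Unique (below b)
below-unique [] = All.[] AllPairs.∷ AllPairs.[]
below-unique (x ∷ b) = concatMap-map-unique _∷_ (λ _ → below b) (Uniqueₚ.downFrom⁺ (suc x))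
  (λ _ → Uniqueₚ.map⁺ Vecₚ.∷-injectiveʳ (below-unique b)) (λ _ _ → Vecₚ.∷-injectiveˡ)

columnSums : List (Vec ℕ m) → Vec ℕ m
columnSums [] = 0ᵛ
columnSums (r ∷ M) = r +ᵛ columnSums M

allZero : Vec ℕ m → Bool
allZero [] = true
allZero (zero ∷ b) = allZero b
allZero (suc _ ∷ b) = false

allZero-0ᵛ : ∀ m → allZero (0ᵛ {m}) ≡ true
allZero-0ᵛ zero = refl
allZero-0ᵛ (suc m) = allZero-0ᵛ m

allZero⇒≡0ᵛ : (b : Vec ℕ m) → allZero b ≡ true → b ≡ 0ᵛ
allZero⇒≡0ᵛ [] _ = refl
allZero⇒≡0ᵛ (zero ∷ b) b≡0 = cong (0 ∷_) (allZero⇒≡0ᵛ b b≡0)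

-- The N-row matrices with column sums b, listed by the column sums c of all rows but the first
-- (so that the first row is b ∸ᵛ c).
matrices : ℕ → Vec ℕ m → List (List (Vec ℕ m))
matrices zero b = if allZero b then [ [] ] else []
matrices (suc N) b = concatMap (λ c → map (b ∸ᵛ c ∷_) (matrices N c)) (below b)

∈-matrices⁻ : ∀ N (b : Vec ℕ m) {M} → M ∈ matrices N b → length M ≡ N × columnSums M ≡ b
∈-matrices⁻ zero b M∈ with allZero b in b≡0
∈-matrices⁻ zero b (here refl) | true = refl , sym (allZero⇒≡0ᵛ b b≡0)
∈-matrices⁻ (suc N) b M∈ with ∈-concatMap-map⁻ (λ c → b ∸ᵛ c ∷_) (matrices N) (below b) M∈
... | c , M , c∈ , M∈ , refl with ∈-matrices⁻ N c M∈
... | refl , refl = refl , ∸ᵛ-+ᵛ (∈-below⁻ b c∈)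

∈-matrices⁺ : ∀ {N b} (M : List (Vec ℕ m)) → length M ≡ N → columnSums M ≡ b → M ∈ matrices N b
∈-matrices⁺ {m} [] refl refl rewrite allZero-0ᵛ m = here refl
∈-matrices⁺ (r ∷ M) refl refl = subst (λ r′ → r′ ∷ M ∈ matrices (suc (length M)) (r +ᵛ columnSums M)) (+ᵛ-∸ᵛ r (columnSums M))
  (∈-concatMap-map⁺ (λ c → r +ᵛ columnSums M ∸ᵛ c ∷_) (matrices (length M))
    (∈-below⁺ (≤ᵛ-+ᵛ r (columnSums M))) (∈-matrices⁺ M refl refl))

matrices-unique : ∀ N (b : Vec ℕ m) → Unique (matrices N b)
matrices-unique zero b with allZero b
... | true = All.[] AllPairs.∷ AllPairs.[]
... | false = AllPairs.[]
matrices-unique (suc N) b = concatMap-map-unique (λ c → b ∸ᵛ c ∷_) (matrices N) (below-unique b)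
  (λ c → Uniqueₚ.map⁺ ∷-injectiveʳ (matrices-unique N c)) column-sums-agree
  where
  column-sums-agree : ∀ {c c′ M M′} → M ∈ matrices N c → M′ ∈ matrices N c′ → b ∸ᵛ c ∷ M ≡ b ∸ᵛ c′ ∷ M′ → c ≡ c′
  column-sums-agree M∈ M′∈ eq with refl ← ∷-injectiveʳ eq = trans (sym (proj₂ (∈-matrices⁻ N _ M∈))) (proj₂ (∈-matrices⁻ N _ M′∈))

compositionCount : ℕ → ℕ → ℕ
compositionCount zero zero = 1
compositionCount zero (suc _) = 0
compositionCount (suc N) x = sum (map (compositionCount N) (downFrom (suc x)))

compositionCount-one : ∀ x → compositionCount 1 x ≡ 1
compositionCount-one zero = refl
compositionCount-one (suc x) = compositionCount-one x

compositionCount-suc : ∀ N x → compositionCount (suc N) x ≡ (N + x) C x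
compositionCount-suc zero x = trans (compositionCount-one x) (sym (nCn≡1 x))
compositionCount-suc (suc N) zero = trans (+-identityʳ _) (compositionCount-suc N zero)
compositionCount-suc (suc N) (suc x) = begin
  compositionCount (suc N) (suc x) + compositionCount (2 + N) x ≡⟨ cong₂ _+_ (compositionCount-suc N (suc x)) (compositionCount-suc (suc N) x) ⟩
  (N + suc x) C suc x + (suc N + x) C x                          ≡⟨ cong (λ y → y C suc x + (suc N + x) C x) (+-suc N x) ⟩
  (suc N + x) C suc x + (suc N + x) C x                          ≡⟨ +-comm _ ((suc N + x) C x) ⟩
  (suc N + x) C x + (suc N + x) C suc x                          ≡⟨ nCk+nC[k+1]≡[n+1]C[k+1] (suc N + x) x ⟩
  suc (suc N + x) C suc x                                        ≡⟨ cong (_C suc x) (sym (+-suc (suc N) x)) ⟩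
  (suc N + suc x) C suc x                                        ∎
  where open ≡-Reasoning

sum-below-product : (g : ℕ → ℕ) (b : Vec ℕ m) →
  sum (map (λ c → product (map g (toList c))) (below b)) ≡ product (map (λ x → sum (map g (downFrom (suc x)))) (toList b))
sum-below-product g [] = refl
sum-below-product g (x ∷ b) = begin
  sum (map G (concatMap (λ j → map (j ∷_) (below b)) (downFrom (suc x))))
    ≡⟨ sum-map-concatMap G (λ j → map (j ∷_) (below b)) (downFrom (suc x)) ⟩
  sum (map (λ j → sum (map G (map (j ∷_) (below b)))) (downFrom (suc x)))
    ≡⟨ cong sum (map-cong (λ j → trans (cong sum (sym (map-∘ (below b)))) (sum-map-*ˡ (g j) G (below b))) (downFrom (suc x))) ⟩
  sum (map (λ j → g j * sum (map G (below b))) (downFrom (suc x)))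
    ≡⟨ sum-map-*ʳ (sum (map G (below b))) g (downFrom (suc x)) ⟩
  sum (map g (downFrom (suc x))) * sum (map G (below b))
    ≡⟨ cong (sum (map g (downFrom (suc x))) *_) (sum-below-product g b) ⟩
  product (map (λ x → sum (map g (downFrom (suc x)))) (toList (x ∷ b))) ∎
  where
  open ≡-Reasoning
  G : ∀ {l} → Vec ℕ l → ℕ
  G c = product (map g (toList c))

length-matrices : ∀ N (b : Vec ℕ m) → length (matrices N b) ≡ product (map (compositionCount N) (toList b))
length-matrices zero b = trans (length-singleton-if (allZero b) []) (allZero-product b)
  where
  length-singleton-if : {X : Set} (t : Bool) (x : X) → length (if t then [ x ] else []) ≡ (if t then 1 else 0)
  length-singleton-if true _ = refl
  length-singleton-if false _ = refl
  allZero-product : ∀ {l} (b : Vec ℕ l) → (if allZero b then 1 else 0) ≡ product (map (compositionCount 0) (toList b))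
  allZero-product [] = refl
  allZero-product (zero ∷ b) = trans (allZero-product b) (sym (+-identityʳ _))
  allZero-product (suc x ∷ b) = refl
length-matrices (suc N) b = begin
  length (concatMap (λ c → map (b ∸ᵛ c ∷_) (matrices N c)) (below b))
    ≡⟨ length-concatMap (λ c → map (b ∸ᵛ c ∷_) (matrices N c)) (below b) ⟩
  sum (map (λ c → length (map (b ∸ᵛ c ∷_) (matrices N c))) (below b))
    ≡⟨ cong sum (map-cong (λ c → trans (length-map _ (matrices N c)) (length-matrices N c)) (below b)) ⟩
  sum (map (λ c → product (map (compositionCount N) (toList c))) (below b))
    ≡⟨ sum-below-product (compositionCount N) b ⟩
  product (map (compositionCount (suc N)) (toList b)) ∎
  where open ≡-Reasoning

-- The cycle lemma

rotate : ℕ → List A → List A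
rotate r xs = drop r xs ++ take r xs

PrefixSumsBelow : ℕ → ℕ → List ℕ → Set
PrefixSumsBelow s i [] = ⊤
PrefixSumsBelow s i (x ∷ xs) = s + x < suc i × PrefixSumsBelow (s + x) (suc i) xs

prefixSumsBelow? : ∀ s i xs → Dec (PrefixSumsBelow s i xs)
prefixSumsBelow? s i [] = yes tt
prefixSumsBelow? s i (x ∷ xs) = (s + x <? suc i) ×-dec prefixSumsBelow? (s + x) (suc i) xs

prefixSumsBelow⁻ : ∀ s i xs → PrefixSumsBelow s i xs → ∀ j → 0 < j → j ≤ length xs → s + sum (take j xs) < i + j
prefixSumsBelow⁻ s i (x ∷ xs) (s+x<1+i , _) 1 _ _ =
  subst₂ _<_ (cong (s +_) (sym (+-identityʳ x))) (+-comm 1 i) s+x<1+i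
prefixSumsBelow⁻ s i (x ∷ xs) (_ , rest) (suc (suc j)) _ (s≤s j<l) =
  subst₂ _<_ (+-assoc s x _) (sym (+-suc i (suc j))) (prefixSumsBelow⁻ (s + x) (suc i) xs rest (suc j) z<s j<l)

prefixSumsBelow⁺ : ∀ s i xs → (∀ j → 0 < j → j ≤ length xs → s + sum (take j xs) < i + j) → PrefixSumsBelow s i xs
prefixSumsBelow⁺ s i [] _ = tt
prefixSumsBelow⁺ s i (x ∷ xs) below =
  subst₂ _<_ (cong (s +_) (+-identityʳ x)) (+-comm i 1) (below 1 z<s (s≤s z≤n)) ,
  prefixSumsBelow⁺ (s + x) (suc i) xs (λ j 0<j j≤l →
    subst₂ _<_ (sym (+-assoc s x _)) (+-suc i j) (below (suc j) z<s (s≤s j≤l)))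

prefixSumsBelow-++⁻ : ∀ s i xs ys → PrefixSumsBelow s i (xs ++ ys) →
  PrefixSumsBelow s i xs × PrefixSumsBelow (s + sum xs) (i + length xs) ys
prefixSumsBelow-++⁻ s i [] ys below = tt , subst₂ (λ s i → PrefixSumsBelow s i ys) (sym (+-identityʳ s)) (sym (+-identityʳ i)) below
prefixSumsBelow-++⁻ s i (x ∷ xs) ys (s+x<1+i , rest) with prefixSumsBelow-++⁻ (s + x) (suc i) xs ys rest
... | below-xs , below-ys =
  (s+x<1+i , below-xs) , subst₂ (λ s i → PrefixSumsBelow s i ys) (+-assoc s x (sum xs)) (sym (+-suc i (length xs))) below-ys

prefixSumsBelow-++⁺ : ∀ s i xs ys → PrefixSumsBelow s i xs → PrefixSumsBelow (s + sum xs) (i + length xs) ys →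
  PrefixSumsBelow s i (xs ++ ys)
prefixSumsBelow-++⁺ s i [] ys _ below-ys = subst₂ (λ s i → PrefixSumsBelow s i ys) (+-identityʳ s) (+-identityʳ i) below-ys
prefixSumsBelow-++⁺ s i (x ∷ xs) ys (s+x<1+i , below-xs) below-ys = s+x<1+i , prefixSumsBelow-++⁺ (s + x) (suc i) xs ys below-xs
  (subst₂ (λ s i → PrefixSumsBelow s i ys) (sym (+-assoc s x (sum xs))) (+-suc i (length xs)) below-ys)

take-+ : (r i : ℕ) (xs : List A) → take (r + i) xs ≡ take r xs ++ take i (drop r xs)
take-+ zero i xs = refl
take-+ (suc r) i [] = sym (take-[] i)
take-+ (suc r) i (x ∷ xs) = cong (x ∷_) (take-+ r i xs)

-- The rotation of u whose prefix sums stay below their lengths starts right after the last index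
-- r ≤ n maximising r ∸ p r, where p r is the sum of the first r entries of u.
module CycleLemma (u : List ℕ) (n : ℕ) (length-u : length u ≡ suc n) (sum-u : sum u ≡ n) where

  private
    N = suc n

  p : ℕ → ℕ
  p j = sum (take j u)

  p-N : p N ≡ n
  p-N = trans (cong p (sym length-u)) (trans (cong sum (take-all (length u) u ≤-refl)) sum-u)

  -- a ≼ b says a ∸ p a ≤ b ∸ p b, and a ≺ b says a ∸ p a < b ∸ p b, phrased without subtraction.
  _≼_ _≺_ : ℕ → ℕ → Set
  a ≼ b = p a + b ≤ p b + a
  a ≺ b = p a + b < p b + a

  ≼-trans : ∀ a b c → a ≼ b → b ≼ c → a ≼ c
  ≼-trans a b c ab bc = +-cancelʳ-≤ (p b + b) (p a + c) (p c + a)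
    (subst₂ _≤_ (rearrange (p a) b (p b) c) (rearrange′ (p b) a (p c) b) (+-mono-≤ ab bc))
    where
    rearrange : ∀ pa b pb c → (pa + b) + (pb + c) ≡ (pa + c) + (pb + b)
    rearrange = solve-∀
    rearrange′ : ∀ pb a pc b → (pb + a) + (pc + b) ≡ (pc + a) + (pb + b)
    rearrange′ = solve-∀

  LastMax : ℕ → Set
  LastMax r = (∀ j → j ≤ r → j ≼ r) × (∀ j → r < j → j ≤ N → j ≺ r)

  -- The conditions 0 ≼ r and N ≺ r agree, as p 0 = 0 and p N = n.
  endpoint⁺ : ∀ r → r ≤ p r → N ≺ r
  endpoint⁺ r r≤pr = begin-strict
    p N + r   ≡⟨ cong (_+ r) p-N ⟩
    n + r     ≤⟨ +-monoʳ-≤ n r≤pr ⟩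
    n + p r   <⟨ n<1+n _ ⟩
    suc (n + p r) ≡⟨ cong suc (+-comm n (p r)) ⟩
    suc (p r + n) ≡⟨ +-suc (p r) n ⟨
    p r + N   ∎
    where open ≤-Reasoning

  endpoint⁻ : ∀ r → N ≺ r → r ≤ p r
  endpoint⁻ r lt = +-cancelˡ-≤ n r (p r) (s≤s⁻¹ (begin-strict
    n + r     ≡⟨ cong (_+ r) p-N ⟨
    p N + r   <⟨ lt ⟩
    p r + N   ≡⟨ +-suc (p r) n ⟩
    suc (p r + n) ≡⟨ cong suc (+-comm (p r) n) ⟩
    suc (n + p r) ∎))
    where open ≤-Reasoning

  lastMax-unique : ∀ {r r′} → r < N → r′ < N → LastMax r → LastMax r′ → r ≡ r′
  lastMax-unique {r} {r′} r<N r′<N (weak , strict) (weak′ , strict′) with <-cmp r r′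
  ... | tri≈ _ r≡r′ _ = r≡r′
  ... | tri< r<r′ _ _ = contradiction (strict r′ r<r′ (<⇒≤ r′<N)) (≤⇒≯ (weak′ r (<⇒≤ r<r′)))
  ... | tri> _ _ r′<r = contradiction (strict′ r r′<r (<⇒≤ r<N)) (≤⇒≯ (weak r′ (<⇒≤ r′<r)))

  lastMax-upTo : ∀ M → Σ[ q ∈ ℕ ] q < suc M × (∀ j → j ≤ q → j ≼ q) × (∀ j → q < j → j < suc M → j ≺ q)
  lastMax-upTo zero = 0 , z<s , (λ { zero _ → ≤-refl }) , (λ j 0<j j<1 → contradiction j<1 (≤⇒≯ 0<j))
  lastMax-upTo (suc M) with lastMax-upTo M
  ... | q , q<1+M , weak , strict with p q + suc M ≤? p (suc M) + q
  ...   | yes q≤M = suc M , ≤-refl , weak′ , (λ j M<j j<2+M → contradiction (s≤s⁻¹ j<2+M) (<⇒≱ M<j))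
    where
    weak′ : ∀ j → j ≤ suc M → j ≼ suc M
    weak′ j j≤1+M with m≤n⇒m<n∨m≡n j≤1+M
    ... | inj₂ refl = ≤-refl
    ... | inj₁ j<1+M with j ≤? q
    ...   | yes j≤q = ≼-trans j q (suc M) (weak j j≤q) q≤M
    ...   | no j≰q = ≼-trans j q (suc M) (<⇒≤ (strict j (≰⇒> j≰q) j<1+M)) q≤M
  ...   | no q≰M = q , m≤n⇒m≤1+n q<1+M , weak , strict′
    where
    strict′ : ∀ j → q < j → j < suc (suc M) → j ≺ q
    strict′ j q<j j<2+M with m≤n⇒m<n∨m≡n (s≤s⁻¹ j<2+M)
    ... | inj₁ j<1+M = strict j q<j j<1+M
    ... | inj₂ refl = ≰⇒> q≰M

  lastMax-exists : Σ[ q ∈ ℕ ] q < N × LastMax q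
  lastMax-exists with lastMax-upTo n
  ... | q , q<N , weak , strict = q , q<N , weak , strict′
    where
    strict′ : ∀ j → q < j → j ≤ N → j ≺ q
    strict′ j q<j j≤N with m≤n⇒m<n∨m≡n j≤N
    ... | inj₁ j<N = strict j q<j j<N
    ... | inj₂ refl = endpoint⁺ q (subst (q ≤_) (+-identityʳ (p q)) (weak 0 z≤n))

  module _ {r : ℕ} (r<N : r < N) where

    private
      xs ys : List ℕ
      xs = drop r u
      ys = take r u

      r≤length : r ≤ length u
      r≤length = subst (r ≤_) (sym length-u) (<⇒≤ r<N)

      length-xs+r : length xs + r ≡ N
      length-xs+r = trans (cong (_+ r) (length-drop r u)) (trans (m∸n+n≡m r≤length) length-u)

      length-ys : length ys ≡ r
      length-ys = trans (length-take r u) (m≤n⇒m⊓n≡m r≤length)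

      p[r]+sum-xs : p r + sum xs ≡ n
      p[r]+sum-xs = trans (sym (sum-++ ys xs)) (trans (cong sum (take++drop≡id r u)) sum-u)

      p-+ : ∀ i → p (r + i) ≡ p r + sum (take i xs)
      p-+ i = trans (cong sum (take-+ r i u)) (sum-++ ys _)

      sum-take-ys : ∀ {j} → j ≤ r → sum (take j ys) ≡ p j
      sum-take-ys j≤r = cong sum (trans (take-take _ r u) (cong (λ k → take k u) (m≤n⇒m⊓n≡m j≤r)))

      shift⁺ : ∀ i → sum (take i xs) < i → (r + i) ≺ r
      shift⁺ i q<i = subst₂ _<_ (trans (swap (p r) _ r) (cong (_+ r) (sym (p-+ i)))) (assoc (p r) r i) (+-monoʳ-< (p r + r) q<i)
        where
        swap : ∀ a q r → (a + r) + q ≡ (a + q) + r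
        swap = solve-∀
        assoc : ∀ a r i → (a + r) + i ≡ a + (r + i)
        assoc = solve-∀

      shift⁻ : ∀ i → (r + i) ≺ r → sum (take i xs) < i
      shift⁻ i lt = +-cancelˡ-< (p r + r) _ i
        (subst₂ _<_ (trans (cong (_+ r) (p-+ i)) (swap (p r) _ r)) (assoc (p r) r i) lt)
        where
        swap : ∀ a q r → (a + q) + r ≡ (a + r) + q
        swap = solve-∀
        assoc : ∀ a r i → a + (r + i) ≡ (a + r) + i
        assoc = solve-∀

      -- After adding p r + r, the inequality for the wrapped-around part becomes j ≼ r,
      -- because p r + sum xs = n and length xs + r = n + 1.
      wrap-sides : ∀ j → (sum xs + p j) + (p r + r) ≡ n + (p j + r) × (length xs + j) + (p r + r) ≡ n + suc (p r + j)
      wrap-sides j =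
        trans (left (sum xs) (p j) (p r) r) (cong (_+ (p j + r)) p[r]+sum-xs) ,
        trans (right (length xs) j (p r) r) (trans (cong (_+ (p r + j)) length-xs+r) (sym (+-suc n _)))
        where
        left : ∀ D pj pr r → (D + pj) + (pr + r) ≡ (pr + D) + (pj + r)
        left = solve-∀
        right : ∀ d j pr r → (d + j) + (pr + r) ≡ (d + r) + (pr + j)
        right = solve-∀

      wrap⁺ : ∀ {j} → j ≤ r → sum xs + sum (take j ys) < length xs + j → j ≼ r
      wrap⁺ {j} j≤r lt = s≤s⁻¹ (+-cancelˡ-< n _ _ (subst₂ _<_ (proj₁ (wrap-sides j)) (proj₂ (wrap-sides j))
        (+-monoˡ-< (p r + r) (subst (λ t → sum xs + t < length xs + j) (sum-take-ys j≤r) lt))))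

      wrap⁻ : ∀ {j} → j ≤ r → j ≼ r → sum xs + sum (take j ys) < length xs + j
      wrap⁻ {j} j≤r le = subst (λ t → sum xs + t < length xs + j) (sym (sum-take-ys j≤r))
        (+-cancelʳ-< (p r + r) _ _ (subst₂ _<_ (sym (proj₁ (wrap-sides j))) (sym (proj₂ (wrap-sides j))) (+-monoʳ-< n (s≤s le))))

    good⇒lastMax : PrefixSumsBelow 0 0 (rotate r u) → LastMax r
    good⇒lastMax good = weak , strict
      where
      below-xs = proj₁ (prefixSumsBelow-++⁻ 0 0 xs ys good)
      below-ys = proj₂ (prefixSumsBelow-++⁻ 0 0 xs ys good)
      strict : ∀ j → r < j → j ≤ N → j ≺ r
      strict j r<j j≤N = subst (_≺ r) (m+[n∸m]≡n (<⇒≤ r<j))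
        (shift⁺ (j ∸ r) (prefixSumsBelow⁻ 0 0 xs below-xs (j ∸ r) (m<n⇒0<n∸m r<j)
          (+-cancelʳ-≤ r _ _ (subst₂ _≤_ (sym (m∸n+n≡m (<⇒≤ r<j))) (sym length-xs+r) j≤N))))
      weak : ∀ j → j ≤ r → j ≼ r
      weak zero _ = subst (r ≤_) (sym (+-identityʳ (p r))) (endpoint⁻ r (strict N r<N ≤-refl))
      weak j@(suc _) j≤r = wrap⁺ j≤r (prefixSumsBelow⁻ (sum xs) (length xs) ys below-ys j z<s (subst (j ≤_) (sym length-ys) j≤r))

    lastMax⇒good : LastMax r → PrefixSumsBelow 0 0 (rotate r u)
    lastMax⇒good (weak , strict) = prefixSumsBelow-++⁺ 0 0 xs ys
      (prefixSumsBelow⁺ 0 0 xs (λ i 0<i i≤d → shift⁻ i (strict (r + i) (m<m+n r 0<i)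
        (subst (r + i ≤_) (trans (+-comm r _) length-xs+r) (+-monoʳ-≤ r i≤d)))))
      (prefixSumsBelow⁺ (sum xs) (length xs) ys (λ j _ j≤l → let j≤r = subst (j ≤_) length-ys j≤l in wrap⁻ j≤r (weak j j≤r)))

  exactly-one-good-rotation : count (λ r → prefixSumsBelow? 0 0 (rotate r u)) (downFrom N) ≡ 1
  exactly-one-good-rotation with lastMax-exists
  ... | q , q<N , lastMax-q = trans (count-cong (λ r → prefixSumsBelow? 0 0 (rotate r u)) (_≟ q) (downFrom N) good⇔≡q) (count-≟-downFrom N q<N)
    where
    good⇔≡q : ∀ {r} → r ∈ downFrom N → PrefixSumsBelow 0 0 (rotate r u) ⇔ r ≡ q
    good⇔≡q r∈ = let r<N = ∈-downFrom⁻ r∈ in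
      mk⇔ (λ good → lastMax-unique r<N q<N (good⇒lastMax r<N good) lastMax-q) (λ { refl → lastMax⇒good r<N lastMax-q })

-- Rotating matrices

take-length-++ : (xs ys : List A) → take (length xs) (xs ++ ys) ≡ xs
take-length-++ [] ys = refl
take-length-++ (x ∷ xs) ys = cong (x ∷_) (take-length-++ xs ys)

drop-length-++ : (xs ys : List A) → drop (length xs) (xs ++ ys) ≡ ys
drop-length-++ [] ys = refl
drop-length-++ (x ∷ xs) ys = drop-length-++ xs ys

rotate-++ : (xs ys : List A) → rotate (length xs) (xs ++ ys) ≡ ys ++ xs
rotate-++ xs ys = cong₂ _++_ (drop-length-++ xs ys) (take-length-++ xs ys)

rotate-inverse : ∀ r (xs : List A) → rotate (length xs ∸ r) (rotate r xs) ≡ xs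
rotate-inverse r xs = begin
  rotate (length xs ∸ r) (drop r xs ++ take r xs)          ≡⟨ cong (λ k → rotate k (drop r xs ++ take r xs)) (length-drop r xs) ⟨
  rotate (length (drop r xs)) (drop r xs ++ take r xs)     ≡⟨ rotate-++ (drop r xs) (take r xs) ⟩
  take r xs ++ drop r xs                                   ≡⟨ take++drop≡id r xs ⟩
  xs                                                       ∎
  where open ≡-Reasoning

length-rotate : ∀ r (xs : List A) → length (rotate r xs) ≡ length xs
length-rotate r xs = trans (length-++-comm (drop r xs) (take r xs)) (cong length (take++drop≡id r xs))

rotate-injective : ∀ r {xs ys : List A} → rotate r xs ≡ rotate r ys → xs ≡ ys
rotate-injective r {xs} {ys} eq = begin
  xs                                       ≡⟨ rotate-inverse r xs ⟨
  rotate (length xs ∸ r) (rotate r xs)     ≡⟨ cong₂ (λ l zs → rotate (l ∸ r) zs) same-length eq ⟩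
  rotate (length ys ∸ r) (rotate r ys)     ≡⟨ rotate-inverse r ys ⟩
  ys                                       ∎
  where
  open ≡-Reasoning
  same-length : length xs ≡ length ys
  same-length = trans (sym (length-rotate r xs)) (trans (cong length eq) (length-rotate r ys))

rotate-surjective : ∀ {r} (xs : List A) → r ≤ length xs → rotate r (rotate (length xs ∸ r) xs) ≡ xs
rotate-surjective {r = r} xs r≤l =
  subst (λ k → rotate k (rotate (length xs ∸ r) xs) ≡ xs) (m∸[m∸n]≡n r≤l) (rotate-inverse (length xs ∸ r) xs)

map-rotate : {B : Set} (f : A → B) (r : ℕ) (xs : List A) → map f (rotate r xs) ≡ rotate r (map f xs)
map-rotate f r xs = trans (map-++ f (drop r xs) (take r xs)) (sym (cong₂ _++_ (drop-map r xs) (take-map r xs)))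

columnSums-++ : (M M′ : List (Vec ℕ m)) → columnSums (M ++ M′) ≡ columnSums M +ᵛ columnSums M′
columnSums-++ [] M′ = sym (Vecₚ.zipWith-identityˡ +-identityˡ (columnSums M′))
columnSums-++ (r ∷ M) M′ = trans (cong (r +ᵛ_) (columnSums-++ M M′)) (sym (Vecₚ.zipWith-assoc +-assoc r _ _))

columnSums-rotate : ∀ r (M : List (Vec ℕ m)) → columnSums (rotate r M) ≡ columnSums M
columnSums-rotate r M = begin
  columnSums (drop r M ++ take r M)                  ≡⟨ columnSums-++ (drop r M) (take r M) ⟩
  columnSums (drop r M) +ᵛ columnSums (take r M)     ≡⟨ Vecₚ.zipWith-comm +-comm (columnSums (drop r M)) _ ⟩
  columnSums (take r M) +ᵛ columnSums (drop r M)     ≡⟨ columnSums-++ (take r M) (drop r M) ⟨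
  columnSums (take r M ++ drop r M)                  ≡⟨ cong columnSums (take++drop≡id r M) ⟩
  columnSums M                                       ∎
  where open ≡-Reasoning

rotate-∈-matrices : ∀ {N} {b : Vec ℕ m} r {M} → M ∈ matrices N b → rotate r M ∈ matrices N b
rotate-∈-matrices {N = N} r {M} M∈ with ∈-matrices⁻ N _ M∈
... | refl , refl = ∈-matrices⁺ (rotate r M) (length-rotate r M) (columnSums-rotate r M)

rowSums : List (Vec ℕ m) → List ℕ
rowSums = map (sum ∘ toList)

sum-rowSums : (M : List (Vec ℕ m)) → sum (rowSums M) ≡ sum (toList (columnSums M))
sum-rowSums {m} [] = sym (sum-0ᵛ m)
sum-rowSums (r ∷ M) = trans (cong (sum (toList r) +_) (sum-rowSums M)) (sym (sum-+ᵛ r (columnSums M)))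

sum≡0⇒≡0ᵛ : (r : Vec ℕ m) → sum (toList r) ≡ 0 → r ≡ 0ᵛ
sum≡0⇒≡0ᵛ [] _ = refl
sum≡0⇒≡0ᵛ (zero ∷ r) sum≡0 = cong (0 ∷_) (sum≡0⇒≡0ᵛ r sum≡0)

rowSumsBelow? : ∀ i (M : List (Vec ℕ m)) → Dec (PrefixSumsBelow 0 i (rowSums M))
rowSumsBelow? i M = prefixSumsBelow? 0 i (rowSums M)

module _ (n : ℕ) (b : Vec ℕ m) where

  private
    N = suc n

  one-rotation-rowSumsBelow : sum (toList b) ≡ n → ∀ {M} → M ∈ matrices N b →
    count (λ r → rowSumsBelow? 0 (rotate r M)) (downFrom N) ≡ 1
  one-rotation-rowSumsBelow sum-b {M} M∈ with ∈-matrices⁻ N b M∈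
  ... | length-M , columnSums-M = trans
    (count-cong (λ r → rowSumsBelow? 0 (rotate r M)) (λ r → prefixSumsBelow? 0 0 (rotate r (rowSums M))) (downFrom N)
      (λ {r} _ → let eq = map-rotate (sum ∘ toList) r M in
        mk⇔ (subst (PrefixSumsBelow 0 0) eq) (subst (PrefixSumsBelow 0 0) (sym eq))))
    (CycleLemma.exactly-one-good-rotation (rowSums M) n
      (trans (length-map _ M) length-M) (trans (sum-rowSums M) (trans (cong (sum ∘ toList) columnSums-M) sum-b)))

  count-rowSumsBelow-rotate : ∀ {r} → r ≤ N → count (λ M → rowSumsBelow? 0 (rotate r M)) (matrices N b) ≡ count (rowSumsBelow? 0) (matrices N b)
  count-rowSumsBelow-rotate {r} r≤N = trans (sym (count-map (rowSumsBelow? 0) (rotate r) (matrices N b)))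
    (count-unique-≡ (rowSumsBelow? 0) (Uniqueₚ.map⁺ (rotate-injective r) (matrices-unique N b)) (matrices-unique N b) (mk⇔ to from))
    where
    to : ∀ {z} → z ∈ map (rotate r) (matrices N b) → z ∈ matrices N b
    to z∈ with ∈-map⁻ (rotate r) z∈
    ... | M , M∈ , refl = rotate-∈-matrices {N = N} {b} r M∈
    from : ∀ {z} → z ∈ matrices N b → z ∈ map (rotate r) (matrices N b)
    from {z} z∈ = subst (_∈ map (rotate r) (matrices N b))
      (rotate-surjective z (subst (r ≤_) (sym (proj₁ (∈-matrices⁻ N b z∈))) r≤N))
      (∈-map⁺ (rotate r) (rotate-∈-matrices {N = N} {b} (length z ∸ r) z∈))

  -- Double count the pairs (M, r) with rotate r M good: each M has exactly one such r, and each
  -- rotate r permutes matrices N b.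
  length-matrices≡N*count : sum (toList b) ≡ n → length (matrices N b) ≡ N * count (rowSumsBelow? 0) (matrices N b)
  length-matrices≡N*count sum-b = begin
    length (matrices N b)                                                  ≡⟨ *-identityʳ _ ⟨
    length (matrices N b) * 1                                              ≡⟨ sum-map-const 1 (matrices N b) ⟨
    sum (map (λ _ → 1) (matrices N b))
      ≡⟨ cong sum (map-cong-local (All.tabulate (one-rotation-rowSumsBelow sum-b))) ⟨
    sum (map (λ M → count (λ r → rowSumsBelow? 0 (rotate r M)) (downFrom N)) (matrices N b))
      ≡⟨ sum-count-comm (λ M r → rowSumsBelow? 0 (rotate r M)) (matrices N b) (downFrom N) ⟩
    sum (map (λ r → count (λ M → rowSumsBelow? 0 (rotate r M)) (matrices N b)) (downFrom N))
      ≡⟨ cong sum (map-cong-local (All.tabulate (λ r∈ → count-rowSumsBelow-rotate (<⇒≤ (∈-downFrom⁻ r∈))))) ⟩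
    sum (map (λ _ → count (rowSumsBelow? 0) (matrices N b)) (downFrom N))              ≡⟨ sum-map-const _ (downFrom N) ⟩
    length (downFrom N) * count (rowSumsBelow? 0) (matrices N b)
      ≡⟨ cong (_* count (rowSumsBelow? 0) (matrices N b)) (length-downFrom N) ⟩
    N * count (rowSumsBelow? 0) (matrices N b)                                         ∎
    where open ≡-Reasoning

  count-rowSumsBelow-shift : count (rowSumsBelow? 0) (matrices N b) ≡ count (rowSumsBelow? 1) (matrices n b)
  count-rowSumsBelow-shift = trans
    (unique-length-≡ (Uniqueₚ.filter⁺ (rowSumsBelow? 0) (matrices-unique N b))
      (Uniqueₚ.map⁺ ∷-injectiveʳ (Uniqueₚ.filter⁺ (rowSumsBelow? 1) (matrices-unique n b))) (mk⇔ to from))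
    (length-map (0ᵛ ∷_) (filter (rowSumsBelow? 1) (matrices n b)))
    where
    to : ∀ {z} → z ∈ filter (rowSumsBelow? 0) (matrices N b) → z ∈ map (0ᵛ ∷_) (filter (rowSumsBelow? 1) (matrices n b))
    to z∈ with ∈-filter⁻ (rowSumsBelow? 0) z∈
    ... | z∈′ , good with ∈-matrices⁻ N b z∈′
    to {r ∷ M} _ | _ , (sum-r<1 , shifted) | length-M , columnSums-M with sum≡0⇒≡0ᵛ r (n≤0⇒n≡0 (s≤s⁻¹ sum-r<1))
    ... | refl = ∈-map⁺ (0ᵛ ∷_) (∈-filter⁺ (rowSumsBelow? 1)
      (∈-matrices⁺ M (suc-injective length-M) (trans (sym (Vecₚ.zipWith-identityˡ +-identityˡ (columnSums M))) columnSums-M))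
      (subst (λ s → PrefixSumsBelow s 1 (rowSums M)) (sum-0ᵛ m) shifted))
    from : ∀ {z} → z ∈ map (0ᵛ ∷_) (filter (rowSumsBelow? 1) (matrices n b)) → z ∈ filter (rowSumsBelow? 0) (matrices N b)
    from z∈ with ∈-map⁻ (0ᵛ ∷_) z∈
    ... | M , M∈ , refl with ∈-filter⁻ (rowSumsBelow? 1) M∈
    ... | M∈′ , shifted with ∈-matrices⁻ n b M∈′
    ... | refl , refl = ∈-filter⁺ (rowSumsBelow? 0)
      (∈-matrices⁺ (0ᵛ ∷ M) refl (Vecₚ.zipWith-identityˡ +-identityˡ (columnSums M)))
      (subst (_< 1) (sym (sum-0ᵛ m)) z<s , subst (λ s → PrefixSumsBelow s 1 (rowSums M)) (sym (sum-0ᵛ m)) shifted)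

-- Paths as matrices

flatten : List (Vec A m) → List A
flatten = concatMap toList

toList-++-injective : (r r′ : Vec A m) {xs ys : List A} → toList r ++ xs ≡ toList r′ ++ ys → r ≡ r′ × xs ≡ ys
toList-++-injective [] [] eq = refl , eq
toList-++-injective (x ∷ r) (x′ ∷ r′) eq with refl ← ∷-injectiveˡ eq with r≡r′ , xs≡ys ← toList-++-injective r r′ (∷-injectiveʳ eq) =
  cong (x ∷_) r≡r′ , xs≡ys

flatten-injective : (M M′ : List (Vec A (suc m))) → flatten M ≡ flatten M′ → M ≡ M′
flatten-injective [] [] _ = refl
flatten-injective [] ((_ ∷ _) ∷ _) ()
flatten-injective ((_ ∷ _) ∷ _) [] ()
flatten-injective (r ∷ M) (r′ ∷ M′) eq with toList-++-injective r r′ eq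
... | refl , eq′ = cong (r ∷_) (flatten-injective M M′ eq′)

unflatten : (R m : ℕ) (xs : List A) → length xs ≡ R * m → Σ[ M ∈ List (Vec A m) ] length M ≡ R × flatten M ≡ xs
unflatten R m xs length-xs with group R m (Vec.cast length-xs (Vec.fromList xs))
... | rows , xs≡concat = toList rows , Vecₚ.length-toList rows , (begin
  flatten (toList rows)                    ≡⟨ flatten-toList rows ⟨
  toList (Vec.concat rows)                 ≡⟨ cong toList xs≡concat ⟨
  toList (Vec.cast length-xs (Vec.fromList xs)) ≡⟨ Vecₚ.toList-cast length-xs (Vec.fromList xs) ⟩
  toList (Vec.fromList xs)                 ≡⟨ Vecₚ.toList∘fromList xs ⟩
  xs                                       ∎)
  where
  open ≡-Reasoning
  flatten-toList : ∀ {R} (rows : Vec (Vec A m) R) → toList (Vec.concat rows) ≡ flatten (toList rows)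
  flatten-toList [] = refl
  flatten-toList (r ∷ rows) = trans (Vecₚ.toList-++ r (Vec.concat rows)) (cong (toList r ++_) (flatten-toList rows))

∈-allPaths : ∀ w → w ∈ allPaths (length w)
∈-allPaths [] = here refl
∈-allPaths (s ∷ w) = ∈-concatMap-map⁺ (λ p s → s ∷ p) (λ _ → U ∷ D ∷ []) (∈-allPaths w) (step∈ s)
  where
  step∈ : ∀ s → s ∈ U ∷ D ∷ []
  step∈ U = here refl
  step∈ D = there (here refl)

allPaths-unique : ∀ m → Unique (allPaths m)
allPaths-unique zero = All.[] AllPairs.∷ AllPairs.[]
allPaths-unique (suc m) = concatMap-map-unique (λ p s → s ∷ p) (λ _ → U ∷ D ∷ []) (allPaths-unique m)
  (λ p → Uniqueₚ.map⁺ (λ {s} {s′} (eq : s ∷ p ≡ s′ ∷ p) → ∷-injectiveˡ eq) U∷D∷[]-unique)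
  (λ _ _ → ∷-injectiveʳ)
  where
  U∷D∷[]-unique : Unique (U ∷ D ∷ [])
  U∷D∷[]-unique = ((λ ()) All.∷ All.[]) AllPairs.∷ (All.[] AllPairs.∷ AllPairs.[])

module Paths (k′ : ℕ) where

  open import Data.Integer using (+_; -_)

  k : ℕ
  k = suc k′

  -[t]≤m⊖n⇔n≤m+t : ∀ t m n → - (+ t) ℤ.≤ m ⊖ n ⇔ n ≤ m + t
  -[t]≤m⊖n⇔n≤m+t t m n = mk⇔
    (λ le → ℤₚ.drop‿+≤+ (ℤₚ.0≤i-j⇒j≤i (subst (0ℤ ℤ.≤_) shift (ℤₚ.i≤j⇒0≤j-i le))))
    (λ le → ℤₚ.0≤i-j⇒j≤i (subst (0ℤ ℤ.≤_) (sym shift) (ℤₚ.i≤j⇒0≤j-i (ℤ.+≤+ le))))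
    where
    ring : ∀ M N T → (M ℤ.- N) ℤ.- - T ≡ (M ℤ.+ T) ℤ.- N
    ring = ℤ-Ring.solve-∀
    shift : (m ⊖ n) ℤ.- - (+ t) ≡ + (m + t) ℤ.- + n
    shift = trans (cong (ℤ._- - (+ t)) (sym (ℤₚ.[+m]-[+n]≡m⊖n m n)))
      (trans (ring (+ m) (+ n) (+ t)) (cong (ℤ._- + n) (sym (ℤₚ.pos-+ m t))))

  ∣[s-i]⇒s≡i : ∀ {s i} → s < k → i < k → (+ k) ∣ (+ s ℤ.- + i) → s ≡ i
  ∣[s-i]⇒s≡i {s} {i} s<k i<k k∣s-i = ℤₚ.+-injective (ℤₚ.i-j≡0⇒i≡j (+ s) (+ i) (ℤₚ.∣i∣≡0⇒i≡0 (distance≡0 _ refl)))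
    where
    distance<k : ℤ.∣ + s ℤ.- + i ∣ < k
    distance<k = subst (_< k) (cong ℤ.∣_∣ (sym (ℤₚ.[+m]-[+n]≡m⊖n s i))) (≤-<-trans (ℤₚ.∣m⊝n∣≤m⊔n s i) (⊔-lub s<k i<k))
    distance≡0 : ∀ d → ℤ.∣ + s ℤ.- + i ∣ ≡ d → d ≡ 0
    distance≡0 zero _ = refl
    distance≡0 (suc d) eq = contradiction (subst (k ℕᵈ.∣_) eq (∣⇒∣ᵤ k∣s-i)) (ℕᵈ.>⇒∤ (subst (_< k) eq distance<k))

  level : ℕ → ℕ → ℤ
  level x q = x ⊖ q * k

  level-U : ∀ x q → level x q ℤ.+ δ k U ≡ level (suc x) q
  level-U x q = trans (ℤₚ.distribˡ-⊖-+-pos 1 x (q * k)) (cong (_⊖ q * k) (+-comm x 1))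

  level-D : ∀ x q → level x q ℤ.+ δ k D ≡ level x (suc q)
  level-D x q = trans (ℤₚ.distribˡ-⊖-+-neg k′ x (q * k)) (cong (λ y → x ⊖ suc y) (+-comm (q * k) k′))

  -- Above x q w: w, started after x up-steps and q down-steps, never goes below -k′.
  Above : ℕ → ℕ → List Step → Set
  Above x q [] = ⊤
  Above x q (U ∷ w) = q * k ≤ suc x + k′ × Above (suc x) q w
  Above x q (D ∷ w) = suc q * k ≤ x + k′ × Above x (suc q) w

  above⁻ : ∀ x q w → All (λ h → - (+ k′) ℤ.≤ h) (heights k (level x q) w) → Above x q w
  above⁻ x q [] [] = tt
  above⁻ x q (U ∷ w) hs with level x q ℤ.+ δ k U | level-U x q
  above⁻ x q (U ∷ w) (h ∷ hs) | _ | refl = Equivalence.to (-[t]≤m⊖n⇔n≤m+t k′ _ _) h , above⁻ (suc x) q w hs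
  above⁻ x q (D ∷ w) hs with level x q ℤ.+ δ k D | level-D x q
  above⁻ x q (D ∷ w) (h ∷ hs) | _ | refl = Equivalence.to (-[t]≤m⊖n⇔n≤m+t k′ _ _) h , above⁻ x (suc q) w hs

  above⁺ : ∀ x q w → Above x q w → All (λ h → - (+ k′) ℤ.≤ h) (heights k (level x q) w)
  above⁺ x q [] tt = []
  above⁺ x q (U ∷ w) (le , above) with level x q ℤ.+ δ k U | level-U x q
  ... | _ | refl = Equivalence.from (-[t]≤m⊖n⇔n≤m+t k′ _ _) le ∷ above⁺ (suc x) q w above
  above⁺ x q (D ∷ w) (le , above) with level x q ℤ.+ δ k D | level-D x q
  ... | _ | refl = Equivalence.from (-[t]≤m⊖n⇔n≤m+t k′ _ _) le ∷ above⁺ x (suc q) w above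

  encodeRow : List ℕ → List Step
  encodeRow = concatMap (λ e → U ∷ replicate e D)

  encode : List (Vec ℕ k) → List Step
  encode = concatMap (encodeRow ∘ toList)

  threshold : ∀ {s} q c → s < k → q * k ≤ s + c * k ⇔ q ≤ c
  threshold {s} q c s<k = mk⇔
    (λ le → ≮⇒≥ (λ c<q → <-irrefl refl (begin-strict
      suc c * k   ≤⟨ *-monoˡ-≤ k c<q ⟩
      q * k       ≤⟨ le ⟩
      s + c * k   <⟨ +-monoˡ-< (c * k) s<k ⟩
      suc c * k   ∎)))
    (λ q≤c → ≤-trans (*-monoˡ-≤ k q≤c) (m≤n+m (c * k) s))
    where open ≤-Reasoning

  column<k : ∀ {s} {e : ℕ} {es} → s + length (e ∷ es) ≡ k → s < k
  column<k {s} s+l≡k = subst (s <_) s+l≡k (m<m+n s z<s)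

  module _ (c : ℕ) where

    -- In row c, after the up-step of column s < k, the path has made suc s + c * k up-steps.
    column-threshold : ∀ {s} q → s < k → q * k ≤ suc s + c * k + k′ ⇔ q ≤ suc c
    column-threshold {s} q s<k = subst (λ y → q * k ≤ y ⇔ q ≤ suc c) (rearrange s c k′) (threshold q (suc c) s<k)
      where
      rearrange : ∀ s c k′ → s + suc c * suc k′ ≡ suc s + c * suc k′ + k′
      rearrange = solve-∀

    run⁻ : ∀ {s} → s < k → ∀ e q w → q ≤ suc c → Above (suc s + c * k) q (replicate e D ++ w) →
      q + e ≤ suc c × Above (suc s + c * k) (q + e) w
    run⁻ {s} s<k zero q w q≤ above =
      subst (_≤ suc c) (sym (+-identityʳ q)) q≤ , subst (λ q → Above (suc s + c * k) q w) (sym (+-identityʳ q)) above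
    run⁻ {s} s<k (suc e) q w _ (le , above) with run⁻ s<k e (suc q) w (Equivalence.to (column-threshold (suc q) s<k) le) above
    ... | bound , above′ = subst (_≤ suc c) (sym (+-suc q e)) bound , subst (λ q → Above (suc s + c * k) q w) (sym (+-suc q e)) above′

    run⁺ : ∀ {s} → s < k → ∀ e q w → q + e ≤ suc c → Above (suc s + c * k) (q + e) w → Above (suc s + c * k) q (replicate e D ++ w)
    run⁺ {s} s<k zero q w _ above = subst (λ q → Above (suc s + c * k) q w) (+-identityʳ q) above
    run⁺ {s} s<k (suc e) q w bound above =
      Equivalence.from (column-threshold (suc q) s<k) (≤-trans (s≤s (m≤m+n q e)) (subst (_≤ suc c) (+-suc q e) bound)) ,
      run⁺ s<k e (suc q) w (subst (_≤ suc c) (+-suc q e) bound) (subst (λ q → Above (suc s + c * k) q w) (+-suc q e) above)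

    row⁻ : ∀ es s q w → s + length es ≡ k → q ≤ suc c → Above (s + c * k) q (encodeRow es ++ w) →
      q + sum es ≤ suc c × Above (suc c * k) (q + sum es) w
    row⁻ [] s q w s+0≡k q≤ above with trans (sym (+-identityʳ s)) s+0≡k
    ... | refl = subst (_≤ suc c) (sym (+-identityʳ q)) q≤ , subst (λ q → Above (suc c * k) q w) (sym (+-identityʳ q)) above
    row⁻ (e ∷ es) s q w s+l≡k q≤ (_ , above)
      with run⁻ (column<k {e = e} {es = es} s+l≡k) e q (encodeRow es ++ w) q≤
                (subst (Above (suc s + c * k) q) (++-assoc (replicate e D) (encodeRow es) w) above)
    ... | bound , above′ with row⁻ es (suc s) (q + e) w (trans (sym (+-suc s _)) s+l≡k) bound above′
    ... | bound′ , above″ = subst (_≤ suc c) (+-assoc q e _) bound′ , subst (λ q → Above (suc c * k) q w) (+-assoc q e _) above″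

    row⁺ : ∀ es s q w → s + length es ≡ k → q + sum es ≤ suc c → Above (suc c * k) (q + sum es) w →
      Above (s + c * k) q (encodeRow es ++ w)
    row⁺ [] s q w s+0≡k bound above with trans (sym (+-identityʳ s)) s+0≡k
    ... | refl = subst (λ q → Above (suc c * k) q w) (+-identityʳ q) above
    row⁺ (e ∷ es) s q w s+l≡k bound above =
      Equivalence.from (column-threshold q s<k) (≤-trans (m≤m+n q _) bound) ,
      subst (Above (suc s + c * k) q) (sym (++-assoc (replicate e D) (encodeRow es) w))
        (run⁺ s<k e q (encodeRow es ++ w) (≤-trans (≤-trans (m≤m+n (q + e) _) (≤-reflexive (+-assoc q e _))) bound)
          (row⁺ es (suc s) (q + e) w (trans (sym (+-suc s _)) s+l≡k) (subst (_≤ suc c) (sym (+-assoc q e _)) bound)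
            (subst (λ q → Above (suc c * k) q w) (sym (+-assoc q e _)) above)))
      where
      s<k : s < k
      s<k = column<k {e = e} {es = es} s+l≡k

  encode-above⁻ : ∀ c q M → q ≤ c → Above (c * k) q (encode M) → PrefixSumsBelow q (suc c) (rowSums M)
  encode-above⁻ c q [] _ _ = tt
  encode-above⁻ c q (r ∷ M) q≤c above with row⁻ c (toList r) 0 q (encode M) (Vecₚ.length-toList r) (m≤n⇒m≤1+n q≤c) above
  ... | bound , above′ = s≤s bound , encode-above⁻ (suc c) (q + sum (toList r)) M bound above′

  encode-above⁺ : ∀ c q M → PrefixSumsBelow q (suc c) (rowSums M) → Above (c * k) q (encode M)
  encode-above⁺ c q [] _ = tt
  encode-above⁺ c q (r ∷ M) (bound , below) =
    row⁺ c (toList r) 0 q (encode M) (Vecₚ.length-toList r) (s≤s⁻¹ bound) (encode-above⁺ (suc c) _ M below)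

  countU-replicate-D : ∀ e → countU (replicate e D) ≡ 0
  countU-replicate-D zero = refl
  countU-replicate-D (suc e) = countU-replicate-D e

  countD-replicate-D : ∀ e → countD (replicate e D) ≡ e
  countD-replicate-D zero = refl
  countD-replicate-D (suc e) = cong suc (countD-replicate-D e)

  countU-encodeRow : ∀ es → countU (encodeRow es) ≡ length es
  countU-encodeRow [] = refl
  countU-encodeRow (e ∷ es) =
    cong suc (trans (count-++ isU? (replicate e D) (encodeRow es)) (cong₂ _+_ (countU-replicate-D e) (countU-encodeRow es)))

  countD-encodeRow : ∀ es → countD (encodeRow es) ≡ sum es
  countD-encodeRow [] = refl
  countD-encodeRow (e ∷ es) =
    trans (count-++ isD? (replicate e D) (encodeRow es)) (cong₂ _+_ (countD-replicate-D e) (countD-encodeRow es))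

  length-encodeRow : ∀ es → length (encodeRow es) ≡ length es + sum es
  length-encodeRow [] = refl
  length-encodeRow (e ∷ es) = cong suc (begin
    length (replicate e D ++ encodeRow es)     ≡⟨ length-++ (replicate e D) ⟩
    length (replicate e D) + length (encodeRow es) ≡⟨ cong₂ _+_ (length-replicate e) (length-encodeRow es) ⟩
    e + (length es + sum es)                   ≡⟨ x∙yz≈y∙xz e (length es) (sum es) ⟩
    length es + (e + sum es)                   ∎)
    where open ≡-Reasoning

  countU-encode : ∀ M → countU (encode M) ≡ length M * k
  countU-encode [] = refl
  countU-encode (r ∷ M) = trans (count-++ isU? (encodeRow (toList r)) (encode M))
    (cong₂ _+_ (trans (countU-encodeRow (toList r)) (Vecₚ.length-toList r)) (countU-encode M))

  countD-encode : ∀ M → countD (encode M) ≡ sum (rowSums M)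
  countD-encode [] = refl
  countD-encode (r ∷ M) = trans (count-++ isD? (encodeRow (toList r)) (encode M)) (cong₂ _+_ (countD-encodeRow (toList r)) (countD-encode M))

  length-encode : ∀ M → length (encode M) ≡ length M * k + sum (rowSums M)
  length-encode [] = refl
  length-encode (r ∷ M) = begin
    length (encodeRow (toList r) ++ encode M)              ≡⟨ length-++ (encodeRow (toList r)) ⟩
    length (encodeRow (toList r)) + length (encode M)      ≡⟨ cong₂ _+_ (length-encodeRow (toList r)) (length-encode M) ⟩
    (length (toList r) + sum (toList r)) + (length M * k + sum (rowSums M))
      ≡⟨ cong (λ l → (l + sum (toList r)) + _) (Vecₚ.length-toList r) ⟩
    (k + sum (toList r)) + (length M * k + sum (rowSums M)) ≡⟨ interchange k (sum (toList r)) (length M * k) _ ⟩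
    (k + length M * k) + (sum (toList r) + sum (rowSums M)) ∎
    where open ≡-Reasoning

  finalHeight-level : ∀ x q w → finalHeight k (level x q) w ≡ level (x + countU w) (q + countD w)
  finalHeight-level x q [] = cong₂ level (sym (+-identityʳ x)) (sym (+-identityʳ q))
  finalHeight-level x q (U ∷ w) with level x q ℤ.+ δ k U | level-U x q
  ... | _ | refl = trans (finalHeight-level (suc x) q w) (cong (λ y → level y (q + countD w)) (sym (+-suc x (countU w))))
  finalHeight-level x q (D ∷ w) with level x q ℤ.+ δ k D | level-D x q
  ... | _ | refl = trans (finalHeight-level x (suc q) w) (cong (level (x + countU w)) (sym (+-suc q (countD w))))

  -- In row c, every down-step of column s ends at a height ≡ s + 1 (mod k).
  level-residue : ∀ {s i} c q → (level (suc s + c * k) q ℤ.- + suc i) ≡ (+ c ℤ.- + q) ℤ.* + k ℤ.+ (+ s ℤ.- + i)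
  level-residue {s} {i} c q = begin
    (suc s + c * k) ⊖ q * k ℤ.- + suc i                               ≡⟨ cong (ℤ._- + suc i) (ℤₚ.[+m]-[+n]≡m⊖n (suc s + c * k) (q * k)) ⟨
    (+ (suc s + c * k) ℤ.- + (q * k)) ℤ.- + suc i
      ≡⟨ cong₂ ℤ._-_ (cong₂ ℤ._-_ (trans (ℤₚ.pos-+ (suc s) (c * k)) (cong₂ ℤ._+_ (ℤₚ.pos-+ 1 s) (ℤₚ.pos-* c k)))
                                  (ℤₚ.pos-* q k))
                     (ℤₚ.pos-+ 1 i) ⟩
    (((+ 1 ℤ.+ + s) ℤ.+ + c ℤ.* + k) ℤ.- + q ℤ.* + k) ℤ.- (+ 1 ℤ.+ + i) ≡⟨ ring (+ s) (+ c) (+ k) (+ q) (+ i) ⟩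
    (+ c ℤ.- + q) ℤ.* + k ℤ.+ (+ s ℤ.- + i)                            ∎
    where
    open ≡-Reasoning
    ring : ∀ S C K Q I → (((+ 1 ℤ.+ S) ℤ.+ C ℤ.* K) ℤ.- Q ℤ.* K) ℤ.- (+ 1 ℤ.+ I) ≡ (C ℤ.- Q) ℤ.* K ℤ.+ (S ℤ.- I)
    ring = ℤ-Ring.solve-∀

  residue⁻ : ∀ {s i} c q → s < k → i < k → (+ k) ∣ (level (suc s + c * k) q ℤ.- + suc i) → s ≡ i
  residue⁻ c q s<k i<k k∣ = ∣[s-i]⇒s≡i s<k i<k
    (∣m+n∣m⇒∣n (subst ((+ k) ∣_) (level-residue c q) k∣) (∣n⇒∣m*n (+ c ℤ.- + q) ∣-refl))

  residue⁺ : ∀ {s} c q → (+ k) ∣ (level (suc s + c * k) q ℤ.- + suc s)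
  residue⁺ {s} c q = subst ((+ k) ∣_) (sym (level-residue c q))
    (∣m∣n⇒∣m+n (∣n⇒∣m*n (+ c ℤ.- + q) ∣-refl) (subst ((+ k) ∣_) (sym (ℤₚ.+-inverseʳ (+ s))) (divides 0ℤ refl)))

  ifEqual : ℕ → ℕ → ℕ → ℕ
  ifEqual zero zero e = e
  ifEqual zero (suc i) e = 0
  ifEqual (suc s) zero e = 0
  ifEqual (suc s) (suc i) e = ifEqual s i e

  ifEqual-≡ : ∀ s e → ifEqual s s e ≡ e
  ifEqual-≡ zero e = refl
  ifEqual-≡ (suc s) e = ifEqual-≡ s e

  ifEqual-≢ : ∀ {s i} e → s ≢ i → ifEqual s i e ≡ 0
  ifEqual-≢ {zero} {zero} e 0≢0 = contradiction refl 0≢0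
  ifEqual-≢ {zero} {suc i} e _ = refl
  ifEqual-≢ {suc s} {zero} e _ = refl
  ifEqual-≢ {suc s} {suc i} e s≢i = ifEqual-≢ e (s≢i ∘ cong suc)

  columnEntry : ℕ → ℕ → List ℕ → ℕ
  columnEntry i s [] = 0
  columnEntry i s (e ∷ es) = ifEqual s i e + columnEntry i (suc s) es

  columnEntry-suc : ∀ i s es → columnEntry (suc i) (suc s) es ≡ columnEntry i s es
  columnEntry-suc i s [] = refl
  columnEntry-suc i s (e ∷ es) = cong (λ y → ifEqual s i e + y) (columnEntry-suc i (suc s) es)

  columnEntry-toList : ∀ {j} (r : Vec ℕ j) (i : Fin j) → columnEntry (toℕ i) 0 (toList r) ≡ lookup r i
  columnEntry-toList (x ∷ r) Fin.zero = trans (cong (λ y → x + y) (left-of-row (toList r) 0)) (+-identityʳ x)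
    where
    left-of-row : ∀ es s → columnEntry 0 (suc s) es ≡ 0
    left-of-row [] s = refl
    left-of-row (e ∷ es) s = left-of-row es (suc s)
  columnEntry-toList (x ∷ r) (Fin.suc i) = trans (columnEntry-suc (toℕ i) 0 (toList r)) (columnEntry-toList r i)

  hasResidue? : ∀ i h → Dec ((+ k) ∣ (h ℤ.- + suc i))
  hasResidue? i h = (+ k) ∣? (h ℤ.- + suc i)

  downCount : ℕ → ℕ → ℕ → List Step → ℕ
  downCount i x q w = count (hasResidue? i) (downEnds k (level x q) w)

  downCount-U : ∀ i x q w → downCount i x q (U ∷ w) ≡ downCount i (suc x) q w
  downCount-U i x q w = cong (λ h → count (hasResidue? i) (downEnds k h w)) (level-U x q)

  downCount-D : ∀ i x q w → downCount i x q (D ∷ w) ≡ count (hasResidue? i) (level x (suc q) ∷ downEnds k (level x (suc q)) w)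
  downCount-D i x q w = cong (λ h → count (hasResidue? i) (h ∷ downEnds k h w)) (level-D x q)

  module _ (c : ℕ) {s : ℕ} where

    run-count-≡ : ∀ e q w → downCount s (suc s + c * k) q (replicate e D ++ w) ≡ e + downCount s (suc s + c * k) (q + e) w
    run-count-≡ zero q w = cong (λ q → downCount s (suc s + c * k) q w) (sym (+-identityʳ q))
    run-count-≡ (suc e) q w = begin
      downCount s X q (D ∷ replicate e D ++ w)     ≡⟨ downCount-D s X q (replicate e D ++ w) ⟩
      count (hasResidue? s) (level X (suc q) ∷ rest)
        ≡⟨ cong length (filter-accept (hasResidue? s) {x = level X (suc q)} {xs = rest} (residue⁺ {s} c (suc q))) ⟩
      suc (downCount s X (suc q) (replicate e D ++ w)) ≡⟨ cong suc (run-count-≡ e (suc q) w) ⟩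
      suc (e + downCount s X (suc q + e) w)        ≡⟨ cong (λ q → suc (e + downCount s X q w)) (sym (+-suc q e)) ⟩
      suc e + downCount s X (q + suc e) w          ∎
      where
      open ≡-Reasoning
      X = suc s + c * k
      rest = downEnds k (level X (suc q)) (replicate e D ++ w)

    run-count-≢ : ∀ {i} → s < k → i < k → s ≢ i → ∀ e q w → downCount i (suc s + c * k) q (replicate e D ++ w) ≡ downCount i (suc s + c * k) (q + e) w
    run-count-≢ {i} s<k i<k s≢i zero q w = cong (λ q → downCount i (suc s + c * k) q w) (sym (+-identityʳ q))
    run-count-≢ {i} s<k i<k s≢i (suc e) q w = begin
      downCount i X q (D ∷ replicate e D ++ w)     ≡⟨ downCount-D i X q (replicate e D ++ w) ⟩
      count (hasResidue? i) (level X (suc q) ∷ rest)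
        ≡⟨ cong length (filter-reject (hasResidue? i) {x = level X (suc q)} {xs = rest} (s≢i ∘ residue⁻ c (suc q) s<k i<k)) ⟩
      downCount i X (suc q) (replicate e D ++ w)   ≡⟨ run-count-≢ s<k i<k s≢i e (suc q) w ⟩
      downCount i X (suc q + e) w                  ≡⟨ cong (λ q → downCount i X q w) (sym (+-suc q e)) ⟩
      downCount i X (q + suc e) w                  ∎
      where
      open ≡-Reasoning
      X = suc s + c * k
      rest = downEnds k (level X (suc q)) (replicate e D ++ w)

    run-count : ∀ {i} → s < k → i < k → ∀ e q w →
      downCount i (suc s + c * k) q (replicate e D ++ w) ≡ ifEqual s i e + downCount i (suc s + c * k) (q + e) w
    run-count {i} s<k i<k e q w with s ≟ i
    ... | yes refl = trans (run-count-≡ e q w) (cong (_+ downCount i (suc s + c * k) (q + e) w) (sym (ifEqual-≡ s e)))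
    ... | no s≢i = trans (run-count-≢ s<k i<k s≢i e q w) (cong (_+ downCount i (suc s + c * k) (q + e) w) (sym (ifEqual-≢ e s≢i)))

  row-count : ∀ c {i} → i < k → ∀ es s q w → s + length es ≡ k →
    downCount i (s + c * k) q (encodeRow es ++ w) ≡ columnEntry i s es + downCount i (suc c * k) (q + sum es) w
  row-count c {i} i<k [] s q w s+0≡k with trans (sym (+-identityʳ s)) s+0≡k
  ... | refl = cong (λ q → downCount i (suc c * k) q w) (sym (+-identityʳ q))
  row-count c {i} i<k (e ∷ es) s q w s+l≡k = begin
    downCount i (s + c * k) q (U ∷ (replicate e D ++ encodeRow es) ++ w)
      ≡⟨ downCount-U i (s + c * k) q ((replicate e D ++ encodeRow es) ++ w) ⟩
    downCount i (suc s + c * k) q ((replicate e D ++ encodeRow es) ++ w)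
      ≡⟨ cong (downCount i (suc s + c * k) q) (++-assoc (replicate e D) (encodeRow es) w) ⟩
    downCount i (suc s + c * k) q (replicate e D ++ encodeRow es ++ w)
      ≡⟨ run-count c (column<k {e = e} {es = es} s+l≡k) i<k e q (encodeRow es ++ w) ⟩
    ifEqual s i e + downCount i (suc s + c * k) (q + e) (encodeRow es ++ w)
      ≡⟨ cong (λ y → ifEqual s i e + y) (row-count c i<k es (suc s) (q + e) w (trans (sym (+-suc s _)) s+l≡k)) ⟩
    ifEqual s i e + (columnEntry i (suc s) es + downCount i (suc c * k) (q + e + sum es) w)
      ≡⟨ +-assoc (ifEqual s i e) _ _ ⟨
    columnEntry i s (e ∷ es) + downCount i (suc c * k) (q + e + sum es) w
      ≡⟨ cong (λ q → columnEntry i s (e ∷ es) + downCount i (suc c * k) q w) (+-assoc q e (sum es)) ⟩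
    columnEntry i s (e ∷ es) + downCount i (suc c * k) (q + sum (e ∷ es)) w ∎
    where open ≡-Reasoning

  downCount-encode : ∀ (i : Fin k) c q M → downCount (toℕ i) (c * k) q (encode M) ≡ lookup (columnSums M) i
  downCount-encode i c q [] = sym (Vecₚ.lookup-replicate i 0)
  downCount-encode i c q (r ∷ M) = begin
    downCount (toℕ i) (c * k) q (encodeRow (toList r) ++ encode M)
      ≡⟨ row-count c (Finₚ.toℕ<n i) (toList r) 0 q (encode M) (Vecₚ.length-toList r) ⟩
    columnEntry (toℕ i) 0 (toList r) + downCount (toℕ i) (suc c * k) (q + sum (toList r)) (encode M)
      ≡⟨ cong₂ _+_ (columnEntry-toList r i) (downCount-encode i (suc c) (q + sum (toList r)) M) ⟩
    lookup r i + lookup (columnSums M) i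
      ≡⟨ Vecₚ.lookup-zipWith _+_ i r (columnSums M) ⟨
    lookup (columnSums (r ∷ M)) i ∎
    where open ≡-Reasoning

  decode : List Step → ℕ × List ℕ
  decode [] = 0 , []
  decode (D ∷ w) = Product.map₁ suc (decode w)
  decode (U ∷ w) = 0 , uncurry _∷_ (decode w)

  decode-sound : ∀ w → replicate (proj₁ (decode w)) D ++ encodeRow (proj₂ (decode w)) ≡ w
  decode-sound [] = refl
  decode-sound (D ∷ w) = cong (D ∷_) (decode-sound w)
  decode-sound (U ∷ w) = cong (U ∷_) (decode-sound w)

  length-decode : ∀ w → length (proj₂ (decode w)) ≡ countU w
  length-decode [] = refl
  length-decode (D ∷ w) = length-decode w
  length-decode (U ∷ w) = cong suc (length-decode w)

  decode-replicate-D : ∀ e w → decode (replicate e D ++ w) ≡ Product.map₁ (λ d → e + d) (decode w)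
  decode-replicate-D zero w = refl
  decode-replicate-D (suc e) w = cong (Product.map₁ suc) (decode-replicate-D e w)

  decode-encodeRow : ∀ es → decode (encodeRow es) ≡ (0 , es)
  decode-encodeRow [] = refl
  decode-encodeRow (e ∷ es) rewrite decode-replicate-D e (encodeRow es) | decode-encodeRow es | +-identityʳ e = refl

  encode≡encodeRow-flatten : ∀ M → encode M ≡ encodeRow (flatten M)
  encode≡encodeRow-flatten [] = refl
  encode≡encodeRow-flatten (r ∷ M) =
    trans (cong (encodeRow (toList r) ++_) (encode≡encodeRow-flatten M)) (sym (concatMap-++ _ (toList r) (flatten M)))

  encode-injective : ∀ {M M′} → encode M ≡ encode M′ → M ≡ M′
  encode-injective {M} {M′} eq = flatten-injective M M′ (begin
    flatten M                                    ≡⟨ cong proj₂ (decode-encodeRow (flatten M)) ⟨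
    proj₂ (decode (encodeRow (flatten M)))       ≡⟨ cong (proj₂ ∘ decode) (encode≡encodeRow-flatten M) ⟨
    proj₂ (decode (encode M))                    ≡⟨ cong (proj₂ ∘ decode) eq ⟩
    proj₂ (decode (encode M′))                   ≡⟨ cong (proj₂ ∘ decode) (encode≡encodeRow-flatten M′) ⟩
    proj₂ (decode (encodeRow (flatten M′)))      ≡⟨ cong proj₂ (decode-encodeRow (flatten M′)) ⟩
    flatten M′                                   ∎)
    where open ≡-Reasoning

  module _ (n : ℕ) (a : Fin k → ℕ) (sum-a : sum (toList (Vec.tabulate a)) ≡ n) where

    private
      b : Vec ℕ k
      b = Vec.tabulate a

    encode-inK : ∀ {M} → M ∈ matrices n b → PrefixSumsBelow 0 1 (rowSums M) → InK k k′ n a (encode M)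
    encode-inK {M} M∈ good with ∈-matrices⁻ n b M∈
    ... | refl , columnSums-M =
      (length-≡ , countD-≡ , countU-≡ , finalHeight-≡ , above⁺ 0 0 (encode M) (encode-above⁺ 0 0 M good)) , has-type
      where
      sum-rows : sum (rowSums M) ≡ n
      sum-rows = trans (sum-rowSums M) (trans (cong (sum ∘ toList) columnSums-M) sum-a)
      length-≡ : length (encode M) ≡ (k + 1) * n
      length-≡ = trans (length-encode M) (trans (cong (λ s → length M * k + s) sum-rows) (rearrange (length M) k))
        where
        rearrange : ∀ n k → n * k + n ≡ (k + 1) * n
        rearrange = solve-∀
      countD-≡ : countD (encode M) ≡ n
      countD-≡ = trans (countD-encode M) sum-rows
      countU-≡ : countU (encode M) ≡ k * length M
      countU-≡ = trans (countU-encode M) (*-comm (length M) k)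
      finalHeight-≡ : finalHeight k 0ℤ (encode M) ≡ 0ℤ
      finalHeight-≡ = trans (finalHeight-level 0 0 (encode M))
        (trans (cong₂ level (countU-encode M) (countD-encode M)) (trans (cong (level (length M * k)) sum-rows) (ℤₚ.n⊖n≡0 (length M * k))))
      has-type : HasType k a (encode M)
      has-type i = trans (downCount-encode i 0 0 M) (trans (cong (λ v → lookup v i) columnSums-M) (Vecₚ.lookup∘tabulate a i))

    inK-encode : ∀ {z} → InK k k′ n a z →
      Σ[ M ∈ List (Vec ℕ k) ] (M ∈ matrices n b × PrefixSumsBelow 0 1 (rowSums M)) × encode M ≡ z
    inK-encode {z} ((_ , _ , countU-z , _ , heights-z) , type-z) =
      M , (∈-matrices⁺ M length-M columnSums-M , encode-above⁻ 0 0 M z≤n (subst (Above 0 0) (sym encode-M) above-z)) , encode-M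
      where
      above-z : Above 0 0 z
      above-z = above⁻ 0 0 z heights-z
      no-leading-D : ∀ w → Above 0 0 w → proj₁ (decode w) ≡ 0
      no-leading-D [] _ = refl
      no-leading-D (U ∷ w) _ = refl
      no-leading-D (D ∷ w) (k≤k′ , _) = contradiction (≤-trans (s≤s (m≤m+n k′ 0)) k≤k′) (1+n≰n)
      es = proj₂ (decode z)
      z≡encodeRow-es : encodeRow es ≡ z
      z≡encodeRow-es = trans (cong (λ e → replicate e D ++ encodeRow es) (sym (no-leading-D z above-z))) (decode-sound z)
      rows = unflatten n k es (trans (length-decode z) (trans countU-z (*-comm k n)))
      M = proj₁ rows
      length-M : length M ≡ n
      length-M = proj₁ (proj₂ rows)
      encode-M : encode M ≡ z
      encode-M = trans (encode≡encodeRow-flatten M) (trans (cong encodeRow (proj₂ (proj₂ rows))) z≡encodeRow-es)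
      columnSums-M : columnSums M ≡ b
      columnSums-M = trans (sym (Vecₚ.tabulate∘lookup (columnSums M))) (Vecₚ.tabulate-cong (λ i → begin
        lookup (columnSums M) i                 ≡⟨ downCount-encode i 0 0 M ⟨
        downCount (toℕ i) 0 0 (encode M)        ≡⟨ cong (downCount (toℕ i) 0 0) encode-M ⟩
        downCount (toℕ i) 0 0 z                 ≡⟨ type-z i ⟩
        a i                                     ∎))
        where open ≡-Reasoning

    cardK≡count-rowSumsBelow : cardK k k′ n a ≡ count (rowSumsBelow? 1) (matrices n b)
    cardK≡count-rowSumsBelow = trans
      (unique-length-≡ (Uniqueₚ.filter⁺ (inK? k k′ n a) (allPaths-unique ((k + 1) * n)))
        (Uniqueₚ.map⁺ encode-injective (Uniqueₚ.filter⁺ (rowSumsBelow? 1) (matrices-unique n b))) (mk⇔ to from))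
      (length-map encode (filter (rowSumsBelow? 1) (matrices n b)))
      where
      to : ∀ {z} → z ∈ filter (inK? k k′ n a) (allPaths ((k + 1) * n)) → z ∈ map encode (filter (rowSumsBelow? 1) (matrices n b))
      to z∈ with inK-encode (proj₂ (∈-filter⁻ (inK? k k′ n a) {xs = allPaths ((k + 1) * n)} z∈))
      ... | M , (M∈ , good) , refl = ∈-map⁺ encode (∈-filter⁺ (rowSumsBelow? 1) M∈ good)
      from : ∀ {z} → z ∈ map encode (filter (rowSumsBelow? 1) (matrices n b)) → z ∈ filter (inK? k k′ n a) (allPaths ((k + 1) * n))
      from z∈ with ∈-map⁻ encode z∈
      ... | M , M∈ , refl with ∈-filter⁻ (rowSumsBelow? 1) M∈
      ... | M∈′ , good with encode-inK M∈′ good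
      ... | inK@((length-≡ , _) , _) = ∈-filter⁺ (inK? k k′ n a) (subst (λ l → encode M ∈ allPaths l) length-≡ (∈-allPaths (encode M))) inK

toList-tabulate : ∀ {n} (f : Fin n → A) → toList (Vec.tabulate f) ≡ List.tabulate f
toList-tabulate {n = zero} f = refl
toList-tabulate {n = suc n} f = cong (f Fin.zero List.∷_) (toList-tabulate (f ∘ Fin.suc))

proposition2p2 : (k n : ℕ) → 1 ≤ k → (a : Fin k → ℕ) → Σᶠ k a ≡ n →
    (n + 1) * cardK k (k ∸ 1) n a ≡ Πᶠ k (λ i → (n + a i) C a i)
proposition2p2 (suc k′) n _ a Σa≡n = begin
  (n + 1) * cardK (suc k′) k′ n a                       ≡⟨ cong₂ _*_ (+-comm n 1) (Paths.cardK≡count-rowSumsBelow k′ n a sum-b) ⟩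
  suc n * count (rowSumsBelow? 1) (matrices n b)        ≡⟨ cong (suc n *_) (count-rowSumsBelow-shift n b) ⟨
  suc n * count (rowSumsBelow? 0) (matrices (suc n) b)  ≡⟨ length-matrices≡N*count n b sum-b ⟨
  length (matrices (suc n) b)                           ≡⟨ length-matrices (suc n) b ⟩
  product (map (compositionCount (suc n)) (toList b))   ≡⟨ cong product (map-cong (compositionCount-suc n) (toList b)) ⟩
  product (map (λ x → (n + x) C x) (toList b))          ≡⟨ cong (product ∘ map (λ x → (n + x) C x)) (toList-tabulate a) ⟩
  product (map (λ x → (n + x) C x) (List.tabulate a))   ≡⟨ cong product (map-tabulate a (λ x → (n + x) C x)) ⟩
  Πᶠ (suc k′) (λ i → (n + a i) C a i)                   ∎
  where
  open ≡-Reasoning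
  b : Vec ℕ (suc k′)
  b = Vec.tabulate a
  sum-b : sum (toList b) ≡ n
  sum-b = trans (cong sum (toList-tabulate a)) Σa≡n
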